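{- The following equations are derivable from $\mathrm{EqFSCL}$: (1) $(x\vee(y\wedge\mathsf F))\wedge(z\wedge\mathsf F)=(\neg x\vee(z\wedge\mathsf F))\wedge(y\wedge\mathsf F)$; (2) $(x\wedge(y\vee\mathsf T))\vee(z\wedge\mathsf F)=(x\vee(z\wedge\mathsf F))\wedge(y\vee\mathsf T)$; (3) $(x\vee\mathsf T)\wedge\neg y=\neg((x\vee\mathsf T)\wedge y)$; (4) $(x\wedge(y\wedge(z\vee\mathsf T)))\vee(w\wedge(z\vee\mathsf T))=((x\wedge y)\vee w)\wedge(z\vee\mathsf T)$; (5) $(x\vee((y\vee\mathsf T)\wedge(z\wedge\mathsf F)))\wedge((w\vee\mathsf T)\wedge(z\wedge\mathsf F))=((x\wedge(w\vee\mathsf T))\vee(y\vee\mathsf T))\wedge(z\wedge\mathsf F)$; (6) $(x\vee((y\vee\mathsf T)\wedge(z\wedge\mathsf F)))\wedge(w\wedge\mathsf F)=((\neg x\wedge(y\vee\mathsf T))\vee(w\wedge\mathsf F))\wedge(z\wedge\mathsf F)$.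
   Context: Terms over constants $\mathsf T,\mathsf F$, unary $\neg$, binary $\wedge,\vee$ (left-sequential connectives), variables $x,y,z,w$. Derivability from EqFSCL means derivability in equational logic from: (F1) $\mathsf F=\neg\mathsf T$; (F2) $x\vee y=\neg(\neg x\wedge\neg y)$; (F3) $\neg\neg x=x$; (F4) $\mathsf T\wedge x=x$; (F5) $x\vee\mathsf F=x$; (F6) $\mathsf F\wedge x=\mathsf F$; (F7) $(x\wedge y)\wedge z=x\wedge(y\wedge z)$; (F8) $\neg x\wedge\mathsf F=x\wedge\mathsf F$; (F9) $(x\wedge\mathsf F)\vee y=(x\vee\mathsf T)\wedge y$; (F10) $(x\wedge y)\vee(z\wedge\mathsf F)=(x\vee(z\wedge\mathsf F))\wedge(y\vee(z\wedge\mathsf F))$. -}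

module Defs where

open import Data.Nat using (ℕ)
open import Data.Product using (_×_)

-- Terms over T, F, ¬, left-sequential ∧ and ∨, with variables indexed by ℕ.
data Term : Set where
  var  : ℕ → Term
  `T   : Term
  `F   : Term
  `¬_  : Term → Term
  _`∧_ : Term → Term → Term
  _`∨_ : Term → Term → Term

infixr 6 _`∧_
infixr 5 _`∨_

x y z w : Term
x = var 0
y = var 1
z = var 2
w = var 3

Subst : Set
Subst = ℕ → Term

_[_] : Term → Subst → Term
var n    [ σ ] = σ n
`T       [ σ ] = `T
`F       [ σ ] = `F
(`¬ t)   [ σ ] = `¬ (t [ σ ])
(s `∧ t) [ σ ] = (s [ σ ]) `∧ (t [ σ ])
(s `∨ t) [ σ ] = (s [ σ ]) `∨ (t [ σ ])

data Axiom : Term → Term → Set where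
  F1  : Axiom `F (`¬ `T)
  F2  : Axiom (x `∨ y) (`¬ ((`¬ x) `∧ (`¬ y)))
  F3  : Axiom (`¬ (`¬ x)) x
  F4  : Axiom (`T `∧ x) x
  F5  : Axiom (x `∨ `F) x
  F6  : Axiom (`F `∧ x) `F
  F7  : Axiom ((x `∧ y) `∧ z) (x `∧ (y `∧ z))
  F8  : Axiom ((`¬ x) `∧ `F) (x `∧ `F)
  F9  : Axiom ((x `∧ `F) `∨ y) ((x `∨ `T) `∧ y)
  F10 : Axiom ((x `∧ y) `∨ (z `∧ `F))
              ((x `∨ (z `∧ `F)) `∧ (y `∨ (z `∧ `F)))

infix 4 EqFSCL⊢_≈_
data EqFSCL⊢_≈_ : Term → Term → Set where
  ax    : ∀ {s t} (σ : Subst) → Axiom s t → EqFSCL⊢ s [ σ ] ≈ t [ σ ]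
  refl  : ∀ {t} → EqFSCL⊢ t ≈ t
  sym   : ∀ {s t} → EqFSCL⊢ s ≈ t → EqFSCL⊢ t ≈ s
  trans : ∀ {s t u} → EqFSCL⊢ s ≈ t → EqFSCL⊢ t ≈ u → EqFSCL⊢ s ≈ u
  cong¬ : ∀ {s t} → EqFSCL⊢ s ≈ t → EqFSCL⊢ `¬ s ≈ `¬ t
  cong∧ : ∀ {s s' t t'} → EqFSCL⊢ s ≈ s' → EqFSCL⊢ t ≈ t' →
          EqFSCL⊢ s `∧ t ≈ s' `∧ t'
  cong∨ : ∀ {s s' t t'} → EqFSCL⊢ s ≈ s' → EqFSCL⊢ t ≈ t' →
          EqFSCL⊢ s `∨ t ≈ s' `∨ t'

-- Two derived facts carry the argument: the De Morgan dual of (F10), by which a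
-- right factor c ∨ T distributes over ∨, and (a ∨ b) ∧ F ≈ ¬a ∧ (b ∧ F), so that
-- under a trailing F only the side effects of a disjunction survive. F-terms
-- c ∧ F are then moved through the context by (F9) and (F10), while T ∨ c ≈ T
-- discards whatever follows a T-term b ∨ T.
module Submission where

open import Data.Nat using (suc)
open import Level using (0ℓ)
open import Data.Product using (_×_; _,_)
open import Relation.Binary.Bundles using (Setoid)
open import Defs

infix 4 _≈_
_≈_ : Term → Term → Set
_≈_ = EqFSCL⊢_≈_

setoid : Setoid 0ℓ 0ℓ
setoid = record
  { Carrier       = Term
  ; _≈_           = _≈_
  ; isEquivalence = record { refl = refl ; sym = sym ; trans = trans }
  }

open import Relation.Binary.Reasoning.Setoid setoid

⟨_,_,_⟩ : Term → Term → Term → Subst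
⟨ a , b , c ⟩ 0             = a
⟨ a , b , c ⟩ 1             = b
⟨ a , b , c ⟩ (suc (suc _)) = c

F≈¬T : `F ≈ `¬ `T
F≈¬T = ax ⟨ `T , `T , `T ⟩ F1

∨-def : ∀ a b → a `∨ b ≈ `¬ ((`¬ a) `∧ (`¬ b))
∨-def a b = ax ⟨ a , b , b ⟩ F2

¬-involutive : ∀ a → `¬ (`¬ a) ≈ a
¬-involutive a = ax ⟨ a , a , a ⟩ F3

∨-identityʳ : ∀ a → a `∨ `F ≈ a
∨-identityʳ a = ax ⟨ a , a , a ⟩ F5

∧-zeroˡ : ∀ a → `F `∧ a ≈ `F
∧-zeroˡ a = ax ⟨ a , a , a ⟩ F6

∧-assoc : ∀ a b c → (a `∧ b) `∧ c ≈ a `∧ (b `∧ c)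
∧-assoc a b c = ax ⟨ a , b , c ⟩ F7

¬-∧F : ∀ a → (`¬ a) `∧ `F ≈ a `∧ `F
¬-∧F a = ax ⟨ a , a , a ⟩ F8

∧F-∨ : ∀ a b → (a `∧ `F) `∨ b ≈ (a `∨ `T) `∧ b
∧F-∨ a b = ax ⟨ a , b , b ⟩ F9

∨∧F-distribʳ-∧ : ∀ a b c →
  (a `∧ b) `∨ (c `∧ `F) ≈ (a `∨ (c `∧ `F)) `∧ (b `∨ (c `∧ `F))
∨∧F-distribʳ-∧ a b c = ax ⟨ a , b , c ⟩ F10

¬F≈T : `¬ `F ≈ `T
¬F≈T = trans (cong¬ F≈¬T) (¬-involutive `T)

deMorgan-∨ : ∀ a b → `¬ (a `∨ b) ≈ (`¬ a) `∧ (`¬ b)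
deMorgan-∨ a b = trans (cong¬ (∨-def a b)) (¬-involutive _)

deMorgan-∧ : ∀ a b → `¬ (a `∧ b) ≈ (`¬ a) `∨ (`¬ b)
deMorgan-∧ a b = begin
  `¬ (a `∧ b)                         ≈⟨ cong¬ (cong∧ (¬-involutive a) (¬-involutive b)) ⟨
  `¬ ((`¬ (`¬ a)) `∧ (`¬ (`¬ b)))     ≈⟨ ∨-def (`¬ a) (`¬ b) ⟨
  (`¬ a) `∨ (`¬ b)                    ∎

¬[∧F]≈∨T : ∀ a → `¬ (a `∧ `F) ≈ a `∨ `T
¬[∧F]≈∨T a = begin
  `¬ (a `∧ `F)             ≈⟨ cong¬ (¬-∧F a) ⟨
  `¬ ((`¬ a) `∧ `F)        ≈⟨ cong¬ (cong∧ refl F≈¬T) ⟩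
  `¬ ((`¬ a) `∧ (`¬ `T))   ≈⟨ ∨-def a `T ⟨
  a `∨ `T                  ∎

¬[∨T]≈∧F : ∀ a → `¬ (a `∨ `T) ≈ a `∧ `F
¬[∨T]≈∧F a = begin
  `¬ (a `∨ `T)             ≈⟨ deMorgan-∨ a `T ⟩
  (`¬ a) `∧ (`¬ `T)        ≈⟨ cong∧ refl F≈¬T ⟨
  (`¬ a) `∧ `F             ≈⟨ ¬-∧F a ⟩
  a `∧ `F                  ∎

∨-zeroˡ : ∀ a → `T `∨ a ≈ `T
∨-zeroˡ a = begin
  `T `∨ a                  ≈⟨ ∨-def `T a ⟩
  `¬ ((`¬ `T) `∧ (`¬ a))   ≈⟨ cong¬ (cong∧ F≈¬T refl) ⟨
  `¬ (`F `∧ (`¬ a))        ≈⟨ cong¬ (∧-zeroˡ _) ⟩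
  `¬ `F                    ≈⟨ ¬F≈T ⟩
  `T                       ∎

∨-assoc : ∀ a b c → (a `∨ b) `∨ c ≈ a `∨ (b `∨ c)
∨-assoc a b c = begin
  (a `∨ b) `∨ c                          ≈⟨ ∨-def _ _ ⟩
  `¬ ((`¬ (a `∨ b)) `∧ (`¬ c))           ≈⟨ cong¬ (cong∧ (deMorgan-∨ a b) refl) ⟩
  `¬ (((`¬ a) `∧ (`¬ b)) `∧ (`¬ c))      ≈⟨ cong¬ (∧-assoc _ _ _) ⟩
  `¬ ((`¬ a) `∧ ((`¬ b) `∧ (`¬ c)))      ≈⟨ cong¬ (cong∧ refl (deMorgan-∨ b c)) ⟨
  `¬ ((`¬ a) `∧ (`¬ (b `∨ c)))           ≈⟨ ∨-def _ _ ⟨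
  a `∨ (b `∨ c)                          ∎

∨T-absorbs-∨ : ∀ a b → (a `∨ `T) `∨ b ≈ a `∨ `T
∨T-absorbs-∨ a b = trans (∨-assoc a `T b) (cong∨ refl (∨-zeroˡ b))

∨T-∧F : ∀ a → (a `∨ `T) `∧ `F ≈ a `∧ `F
∨T-∧F a = trans (sym (∧F-∨ a `F)) (∨-identityʳ _)

-- The De Morgan dual of (F10), obtained by negating its instance at ¬a, ¬b, ¬c.
∧∨T-distribʳ-∨ : ∀ a b c →
  (a `∨ b) `∧ (c `∨ `T) ≈ (a `∧ (c `∨ `T)) `∨ (b `∧ (c `∨ `T))
∧∨T-distribʳ-∨ a b c = begin
  (a `∨ b) `∧ (c `∨ `T)
    ≈⟨ cong∧ (∨-def a b) (sym ¬[¬∧F]) ⟩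
  (`¬ ((`¬ a) `∧ (`¬ b))) `∧ (`¬ ((`¬ c) `∧ `F))
    ≈⟨ deMorgan-∨ _ _ ⟨
  `¬ (((`¬ a) `∧ (`¬ b)) `∨ ((`¬ c) `∧ `F))
    ≈⟨ cong¬ (∨∧F-distribʳ-∧ _ _ _) ⟩
  `¬ (((`¬ a) `∨ ((`¬ c) `∧ `F)) `∧ ((`¬ b) `∨ ((`¬ c) `∧ `F)))
    ≈⟨ deMorgan-∧ _ _ ⟩
  (`¬ ((`¬ a) `∨ ((`¬ c) `∧ `F))) `∨ (`¬ ((`¬ b) `∨ ((`¬ c) `∧ `F)))
    ≈⟨ cong∨ (¬[¬∨¬∧F] a) (¬[¬∨¬∧F] b) ⟩
  (a `∧ (c `∨ `T)) `∨ (b `∧ (c `∨ `T))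
    ∎
  where
  ¬[¬∧F] : `¬ ((`¬ c) `∧ `F) ≈ c `∨ `T
  ¬[¬∧F] = trans (cong¬ (¬-∧F c)) (¬[∧F]≈∨T c)

  ¬[¬∨¬∧F] : ∀ d → `¬ ((`¬ d) `∨ ((`¬ c) `∧ `F)) ≈ d `∧ (c `∨ `T)
  ¬[¬∨¬∧F] d = trans (deMorgan-∨ _ _) (cong∧ (¬-involutive d) ¬[¬∧F])

∨-∧F : ∀ a b → (a `∨ b) `∧ `F ≈ (`¬ a) `∧ (b `∧ `F)
∨-∧F a b = begin
  (a `∨ b) `∧ `F               ≈⟨ ¬-∧F _ ⟨
  (`¬ (a `∨ b)) `∧ `F          ≈⟨ cong∧ (deMorgan-∨ a b) refl ⟩
  ((`¬ a) `∧ (`¬ b)) `∧ `F     ≈⟨ ∧-assoc _ _ _ ⟩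
  (`¬ a) `∧ ((`¬ b) `∧ `F)     ≈⟨ cong∧ refl (¬-∧F b) ⟩
  (`¬ a) `∧ (b `∧ `F)          ∎

∨-∧F-idem : ∀ a b → (a `∨ b) `∧ `F ≈ (a `∨ (b `∧ `F)) `∧ `F
∨-∧F-idem a b = begin
  (a `∨ b) `∧ `F               ≈⟨ ∨-∧F a b ⟩
  (`¬ a) `∧ (b `∧ `F)          ≈⟨ cong∧ refl ∧F-idem ⟨
  (`¬ a) `∧ ((b `∧ `F) `∧ `F)  ≈⟨ ∨-∧F a (b `∧ `F) ⟨
  (a `∨ (b `∧ `F)) `∧ `F       ∎
  where
  ∧F-idem : (b `∧ `F) `∧ `F ≈ b `∧ `F
  ∧F-idem = trans (∧-assoc b `F `F) (cong∧ refl (∧-zeroˡ `F))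

∨∧F-distribʳ-∧∨T : ∀ a b c →
  (a `∧ (b `∨ `T)) `∨ (c `∧ `F) ≈ (a `∨ (c `∧ `F)) `∧ (b `∨ `T)
∨∧F-distribʳ-∧∨T a b c =
  trans (∨∧F-distribʳ-∧ _ _ _) (cong∧ refl (∨T-absorbs-∨ b _))

¬-∨T∧ : ∀ a b → (a `∨ `T) `∧ (`¬ b) ≈ `¬ ((a `∨ `T) `∧ b)
¬-∨T∧ a b = begin
  (a `∨ `T) `∧ (`¬ b)        ≈⟨ cong∧ (¬[∧F]≈∨T a) refl ⟨
  (`¬ (a `∧ `F)) `∧ (`¬ b)   ≈⟨ deMorgan-∨ _ _ ⟨
  `¬ ((a `∧ `F) `∨ b)        ≈⟨ cong¬ (∧F-∨ a b) ⟩
  `¬ ((a `∨ `T) `∧ b)        ∎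

∧∨T-factorʳ : ∀ a b c d →
  (a `∧ (b `∧ (c `∨ `T))) `∨ (d `∧ (c `∨ `T)) ≈ ((a `∧ b) `∨ d) `∧ (c `∨ `T)
∧∨T-factorʳ a b c d =
  trans (cong∨ (sym (∧-assoc _ _ _)) refl) (sym (∧∨T-distribʳ-∨ _ _ _))

∨∧F-∧-∧F : ∀ a b c →
  (a `∨ (b `∧ `F)) `∧ (c `∧ `F) ≈ ((a `∧ (c `∨ `T)) `∨ b) `∧ `F
∨∧F-∧-∧F a b c = begin
  (a `∨ (b `∧ `F)) `∧ (c `∧ `F)           ≈⟨ cong∧ refl (∨T-∧F c) ⟨
  (a `∨ (b `∧ `F)) `∧ ((c `∨ `T) `∧ `F)   ≈⟨ ∧-assoc _ _ _ ⟨
  ((a `∨ (b `∧ `F)) `∧ (c `∨ `T)) `∧ `F   ≈⟨ cong∧ (∨∧F-distribʳ-∧∨T a c b) refl ⟨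
  ((a `∧ (c `∨ `T)) `∨ (b `∧ `F)) `∧ `F   ≈⟨ ∨-∧F-idem _ _ ⟨
  ((a `∧ (c `∨ `T)) `∨ b) `∧ `F           ∎

∧F-exchange : ∀ a b c →
  (a `∨ (b `∧ `F)) `∧ (c `∧ `F) ≈ ((`¬ a) `∨ (c `∧ `F)) `∧ (b `∧ `F)
∧F-exchange a b c = begin
  (a `∨ (b `∧ `F)) `∧ (c `∧ `F)                      ≈⟨ ∨∧F-∧-∧F a b c ⟩
  ((a `∧ (c `∨ `T)) `∨ b) `∧ `F                      ≈⟨ ∨-∧F _ _ ⟩
  (`¬ (a `∧ (c `∨ `T))) `∧ (b `∧ `F)                 ≈⟨ cong∧ ¬[∧∨T] refl ⟩
  ((`¬ a) `∨ (c `∧ `F)) `∧ (b `∧ `F)                 ∎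
  where
  ¬[∧∨T] : `¬ (a `∧ (c `∨ `T)) ≈ (`¬ a) `∨ (c `∧ `F)
  ¬[∧∨T] = trans (deMorgan-∧ _ _) (cong∨ refl (¬[∨T]≈∧F c))

∨T∧F-∧-∨T∧F : ∀ a b c d →
  (a `∨ ((b `∨ `T) `∧ (c `∧ `F))) `∧ ((d `∨ `T) `∧ (c `∧ `F))
    ≈ ((a `∧ (d `∨ `T)) `∨ (b `∨ `T)) `∧ (c `∧ `F)
∨T∧F-∧-∨T∧F a b c d = begin
  (a `∨ ((b `∨ `T) `∧ (c `∧ `F))) `∧ ((d `∨ `T) `∧ (c `∧ `F))
    ≈⟨ cong∧ (cong∨ refl (∧F-∨ _ _)) (∧F-∨ _ _) ⟨
  (a `∨ ((b `∧ `F) `∨ (c `∧ `F))) `∧ ((d `∧ `F) `∨ (c `∧ `F))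
    ≈⟨ cong∧ (∨-assoc _ _ _) refl ⟨
  ((a `∨ (b `∧ `F)) `∨ (c `∧ `F)) `∧ ((d `∧ `F) `∨ (c `∧ `F))
    ≈⟨ ∨∧F-distribʳ-∧ _ _ _ ⟨
  ((a `∨ (b `∧ `F)) `∧ (d `∧ `F)) `∨ (c `∧ `F)
    ≈⟨ cong∨ (∨∧F-∧-∧F a b d) refl ⟩
  (((a `∧ (d `∨ `T)) `∨ b) `∧ `F) `∨ (c `∧ `F)
    ≈⟨ ∧F-∨ _ _ ⟩
  (((a `∧ (d `∨ `T)) `∨ b) `∨ `T) `∧ (c `∧ `F)
    ≈⟨ cong∧ (∨-assoc _ _ _) refl ⟩
  ((a `∧ (d `∨ `T)) `∨ (b `∨ `T)) `∧ (c `∧ `F)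
    ∎

∨T∧F-∧-∧F : ∀ a b c d →
  (a `∨ ((b `∨ `T) `∧ (c `∧ `F))) `∧ (d `∧ `F)
    ≈ (((`¬ a) `∧ (b `∨ `T)) `∨ (d `∧ `F)) `∧ (c `∧ `F)
∨T∧F-∧-∧F a b c d = begin
  (a `∨ ((b `∨ `T) `∧ (c `∧ `F))) `∧ (d `∧ `F)
    ≈⟨ cong∧ (cong∨ refl (∧-assoc _ _ _)) refl ⟨
  (a `∨ (((b `∨ `T) `∧ c) `∧ `F)) `∧ (d `∧ `F)
    ≈⟨ ∧F-exchange _ _ _ ⟩
  ((`¬ a) `∨ (d `∧ `F)) `∧ (((b `∨ `T) `∧ c) `∧ `F)
    ≈⟨ cong∧ refl (∧-assoc _ _ _) ⟩
  ((`¬ a) `∨ (d `∧ `F)) `∧ ((b `∨ `T) `∧ (c `∧ `F))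
    ≈⟨ ∧-assoc _ _ _ ⟨
  (((`¬ a) `∨ (d `∧ `F)) `∧ (b `∨ `T)) `∧ (c `∧ `F)
    ≈⟨ cong∧ (∨∧F-distribʳ-∧∨T _ _ _) refl ⟨
  (((`¬ a) `∧ (b `∨ `T)) `∨ (d `∧ `F)) `∧ (c `∧ `F)
    ∎

lemmaA2 : (EqFSCL⊢ (x `∨ (y `∧ `F)) `∧ (z `∧ `F) ≈ ((`¬ x) `∨ (z `∧ `F)) `∧ (y `∧ `F))
          × (EqFSCL⊢ (x `∧ (y `∨ `T)) `∨ (z `∧ `F) ≈ (x `∨ (z `∧ `F)) `∧ (y `∨ `T))
          × (EqFSCL⊢ (x `∨ `T) `∧ (`¬ y) ≈ `¬ ((x `∨ `T) `∧ y))
          × (EqFSCL⊢ (x `∧ (y `∧ (z `∨ `T))) `∨ (w `∧ (z `∨ `T)) ≈ ((x `∧ y) `∨ w) `∧ (z `∨ `T))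
          × (EqFSCL⊢ (x `∨ ((y `∨ `T) `∧ (z `∧ `F))) `∧ ((w `∨ `T) `∧ (z `∧ `F)) ≈ ((x `∧ (w `∨ `T)) `∨ (y `∨ `T)) `∧ (z `∧ `F))
          × (EqFSCL⊢ (x `∨ ((y `∨ `T) `∧ (z `∧ `F))) `∧ (w `∧ `F) ≈ (((`¬ x) `∧ (y `∨ `T)) `∨ (w `∧ `F)) `∧ (z `∧ `F))
lemmaA2 = ∧F-exchange x y z
        , ∨∧F-distribʳ-∧∨T x y z
        , ¬-∨T∧ x y
        , ∧∨T-factorʳ x y z w
        , ∨T∧F-∧-∨T∧F x y z w
        , ∨T∧F-∧-∧F x y z w
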